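{- For every integer $k\geq1$ there is a well-defined $\mathbb{Q}$-linear map $\partial_k:\mathcal{E}_k\to\mathcal{E}_{k+2}$ given on the $G$-generators by \[ \partial_k\Big(G\begin{bmatrix}k'\\ d\end{bmatrix}\Big)=k'\,G\begin{bmatrix}k'+1\\ d+1\end{bmatrix},\qquad \partial_k\Big(G\begin{bmatrix}k_1,k_2\\ d_1,d_2\end{bmatrix}\Big)=k_1\,G\begin{bmatrix}k_1+1,k_2\\ d_1+1,d_2\end{bmatrix}+k_2\,G\begin{bmatrix}k_1,k_2+1\\ d_1,d_2+1\end{bmatrix}. \]
   Context: Formal double Eisenstein space: for $K\geq1$, $\mathcal{E}_K$ is the $\mathbb{Q}$-vector space spanned by formal symbols $G\begin{bmatrix}k\\ d\end{bmatrix}$ ($k\geq1,d\geq0$, $k+d=K$) and $G\begin{bmatrix}k_1,k_2\\ d_1,d_2\end{bmatrix}$, $P\begin{bmatrix}k_1,k_2\\ d_1,d_2\end{bmatrix}$ ($k_1,k_2\geq1$, $d_1,d_2\geq0$, $k_1+k_2+d_1+d_2=K$), modulo the relations, for all such $k_1,k_2,d_1,d_2$: $P\begin{bmatrix}k_1,k_2\\ d_1,d_2\end{bmatrix}=G\begin{bmatrix}k_1,k_2\\ d_1,d_2\end{bmatrix}+G\begin{bmatrix}k_2,k_1\\ d_2,d_1\end{bmatrix}+G\begin{bmatrix}k_1+k_2\\ d_1+d_2\end{bmatrix}$ $=\sum_{\substack{l_1+l_2=k_1+k_2,\ e_1+e_2=d_1+d_2\\ l_1,l_2\geq1,\ e_1,e_2\geq0}}\left(\binom{l_1-1}{k_1-1}\binom{d_1}{e_1}(-1)^{d_1-e_1}+\binom{l_1-1}{k_2-1}\binom{d_2}{e_1}(-1)^{d_2-e_1}\right)G\begin{bmatrix}l_1,l_2\\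 e_1,e_2\end{bmatrix}+\frac{d_1!\,d_2!}{(d_1+d_2+1)!}\binom{k_1+k_2-2}{k_1-1}G\begin{bmatrix}k_1+k_2-1\\ d_1+d_2+1\end{bmatrix}$. (Since each $P$-symbol equals a combination of $G$-symbols, $\mathcal{E}_K$ is spanned by the $G$-symbols.) -}

module Defs where

open import Data.Nat as ℕ using (ℕ; zero; suc; _∸_; _!; _≡ᵇ_)
open import Data.Nat.Properties using (_!≢0)
open import Data.Nat.Combinatorics using (_C_)
open import Data.Integer using (+_)
open import Data.Rational using (ℚ; 0ℚ; 1ℚ; _+_; _*_; -_; _/_)
open import Data.Bool using (Bool; true; false; _∧_; if_then_else_)
open import Data.List using (List; []; _∷_; _++_; map; concatMap; foldr; upTo)
open import Data.List.Relation.Unary.All using (All)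
open import Data.Product using (_×_; _,_; Σ; proj₂)
open import Relation.Binary.PropositionalEquality using (_≡_)

-- Formal symbols of the double Eisenstein space (all weights at once).
--   G₁ k d            stands for G[k ; d]
--   G₂ k₁ k₂ d₁ d₂    stands for G[k₁,k₂ ; d₁,d₂]
--   P  k₁ k₂ d₁ d₂    stands for P[k₁,k₂ ; d₁,d₂]
data Sym : Set where
  G₁ : ℕ → ℕ → Sym
  G₂ : ℕ → ℕ → ℕ → ℕ → Sym
  P  : ℕ → ℕ → ℕ → ℕ → Sym

_==_ : Sym → Sym → Bool
G₁ a b == G₁ a' b' = (a ≡ᵇ a') ∧ (b ≡ᵇ b')
G₂ a b c d == G₂ a' b' c' d' = (a ≡ᵇ a') ∧ (b ≡ᵇ b') ∧ (c ≡ᵇ c') ∧ (d ≡ᵇ d')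
P a b c d == P a' b' c' d' = (a ≡ᵇ a') ∧ (b ≡ᵇ b') ∧ (c ≡ᵇ c') ∧ (d ≡ᵇ d')
_ == _ = false

-- Elements of the free ℚ-vector space on the symbols: finite formal
-- linear combinations, represented as lists of (coefficient, symbol).
Lin : Set
Lin = List (ℚ × Sym)

coeff : Sym → Lin → ℚ
coeff s [] = 0ℚ
coeff s ((q , t) ∷ v) = (if s == t then q else 0ℚ) + coeff s v

_≈_ : Lin → Lin → Set
v ≈ w = ∀ s → coeff s v ≡ coeff s w

scale : ℚ → Lin → Lin
scale q = map (λ { (c , s) → (q * c , s) })

neg : Lin → Lin
neg = scale (- 1ℚ)

ι : ℕ → ℚ
ι n = + n / 1

sgn : ℕ → ℚ
sgn zero = 1ℚ
sgn (suc n) = - sgn n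

factQuot : ℕ → ℕ → ℚ
factQuot d₁ d₂ = _/_ (+ (d₁ ! ℕ.* d₂ !)) (suc (d₁ ℕ.+ d₂) !) {{suc (d₁ ℕ.+ d₂) !≢0}}

stuffleSide : ℕ → ℕ → ℕ → ℕ → Lin
stuffleSide k₁ k₂ d₁ d₂ =
  (1ℚ , G₂ k₁ k₂ d₁ d₂) ∷ (1ℚ , G₂ k₂ k₁ d₂ d₁) ∷ (1ℚ , G₁ (k₁ ℕ.+ k₂) (d₁ ℕ.+ d₂)) ∷ []

-- the shuffle-type right-hand side:
--  Σ_{l₁+l₂=k₁+k₂, l₁,l₂≥1} Σ_{e₁+e₂=d₁+d₂, e₁,e₂≥0}
--    ( C(l₁-1,k₁-1) C(d₁,e₁) (-1)^{d₁-e₁} + C(l₁-1,k₂-1) C(d₂,e₁) (-1)^{d₂-e₁} ) G[l₁,l₂;e₁,e₂]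
--  + d₁!d₂!/(d₁+d₂+1)! C(k₁+k₂-2,k₁-1) G[k₁+k₂-1 ; d₁+d₂+1]
-- Here l₁ = suc i for i ∈ {0,…,k₁+k₂-2} and e₁ ∈ {0,…,d₁+d₂}.
-- (When e₁ > dⱼ, the binomial C(dⱼ,e₁) vanishes, so truncated subtraction is harmless.)
shuffleSide : ℕ → ℕ → ℕ → ℕ → Lin
shuffleSide k₁ k₂ d₁ d₂ =
  concatMap (λ i → map (λ e₁ →
      ( ι ((i C (k₁ ∸ 1)) ℕ.* (d₁ C e₁)) * sgn (d₁ ∸ e₁)
        + ι ((i C (k₂ ∸ 1)) ℕ.* (d₂ C e₁)) * sgn (d₂ ∸ e₁)
      , G₂ (suc i) (K ∸ suc i) e₁ (D ∸ e₁)))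
    (upTo (suc D)))
    (upTo (K ∸ 1))
  ++ (factQuot d₁ d₂ * ι ((K ∸ 2) C (k₁ ∸ 1)) , G₁ (K ∸ 1) (suc D)) ∷ []
  where
  K = k₁ ℕ.+ k₂
  D = d₁ ℕ.+ d₂

-- The defining relations, as relators (elements which are set to zero):
--   relA : P - (G + G + G)       relB : P - (shuffle side)
data RelKind : Set where
  relA relB : RelKind

relator : RelKind → ℕ → ℕ → ℕ → ℕ → Lin
relator relA k₁ k₂ d₁ d₂ = (1ℚ , P k₁ k₂ d₁ d₂) ∷ neg (stuffleSide k₁ k₂ d₁ d₂)
relator relB k₁ k₂ d₁ d₂ = (1ℚ , P k₁ k₂ d₁ d₂) ∷ neg (shuffleSide k₁ k₂ d₁ d₂)

RelIdx : Set
RelIdx = RelKind × ℕ × ℕ × ℕ × ℕ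

ValidIn : ℕ → RelIdx → Set
ValidIn K (_ , k₁ , k₂ , d₁ , d₂) = (1 ℕ.≤ k₁) × (1 ℕ.≤ k₂) × (k₁ ℕ.+ k₂ ℕ.+ d₁ ℕ.+ d₂ ≡ K)

relOf : RelIdx → Lin
relOf (r , k₁ , k₂ , d₁ , d₂) = relator r k₁ k₂ d₁ d₂

combine : List (ℚ × RelIdx) → Lin
combine = concatMap (λ { (q , ρ) → scale q (relOf ρ) })

-- v lies in the subspace spanned by the weight-K relators
-- (i.e. v represents 0 in 𝓔_K)
InRel : ℕ → Lin → Set
InRel K v = Σ (List (ℚ × RelIdx)) λ c → All (λ x → ValidIn K (proj₂ x)) c × (v ≈ combine c)

extend : (Sym → Lin) → Lin → Lin
extend f = concatMap (λ { (q , s) → scale q (f s) })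

-- The prescribed values of ∂ on G-generators, with values on P-symbols
-- supplied by ∂P.
∂with : (ℕ → ℕ → ℕ → ℕ → Lin) → Sym → Lin
∂with ∂P (G₁ k d) = (ι k , G₁ (suc k) (suc d)) ∷ []
∂with ∂P (G₂ k₁ k₂ d₁ d₂) =
  (ι k₁ , G₂ (suc k₁) k₂ (suc d₁) d₂) ∷ (ι k₂ , G₂ k₁ (suc k₂) d₁ (suc d₂)) ∷ []
∂with ∂P (P k₁ k₂ d₁ d₂) = ∂P k₁ k₂ d₁ d₂

-- Let ∂ act on P-symbols by the same Leibniz rule as on double G-symbols,
-- ∂P[k₁,k₂;d₁,d₂] = k₁ P[k₁+1,k₂;d₁+1,d₂] + k₂ P[k₁,k₂+1;d₁,d₂+1].  Then ∂ maps each
-- relator of weight K to k₁ times one relator plus k₂ times another of weight K+2, as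
-- soon as both sides S of the relations obey the same rule
--   ∂ S(k₁,k₂,d₁,d₂) = k₁ S(k₁+1,k₂,d₁+1,d₂) + k₂ S(k₁,k₂+1,d₁,d₂+1).  For the shuffle side, comparing coefficients
-- of G[l₁,l₂;e₁,e₂] reduces it to the absorption identity (a+1) C(i+1,a+1) = (i+1) C(i,a),
-- Pascal's rule for the signed binomials C(d,e)(-1)^(d-e), and, for the depth-one term,
-- the Beta-integral recurrence d₁!d₂!/(D+1)! = (d₁+1)!d₂!/(D+2)! + d₁!(d₂+1)!/(D+2)!, D = d₁+d₂.

module Submission where

open import Defs
open import Data.Bool using (true; false; if_then_else_)
import Data.Integer as ℤ
import Data.Integer.Properties as ℤ
open import Data.List using (List; []; _∷_; _++_; map; concatMap; applyUpTo; upTo)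
open import Data.List.Properties using (concatMap-++)
open import Data.List.Relation.Unary.All using (All; []; _∷_)
open import Data.Nat as ℕ using (ℕ; zero; suc; _∸_; _!; _<_; _≤_; z≤n; s≤s; NonZero)
open import Data.Nat.Combinatorics using (_C_; nC1≡n; nCk+nC[k+1]≡[n+1]C[k+1]; k>n⇒nCk≡0)
import Data.Nat.Coprimality as Coprimality
open import Data.Nat.Properties as ℕ using (_!≢0)
import Data.Nat.Solver
open import Data.Product using (Σ; _×_; _,_; proj₂)
open import Data.Rational using (ℚ; 0ℚ; 1ℚ; _+_; _*_; -_; _/_; fromℚᵘ)
open import Data.Rational.Properties
import Data.Rational.Solver
import Data.Rational.Unnormalised as ℚᵘ
import Data.Rational.Unnormalised.Properties as ℚᵘ
open import Function using (_∘_)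
open import Relation.Binary.PropositionalEquality
open import Relation.Nullary using (yes; no)

module ℕ-Solver = Data.Nat.Solver.+-*-Solver
module ℚ-Solver = Data.Rational.Solver.+-*-Solver

-- Arithmetic

ι-suc : ∀ n → ι (suc n) ≡ 1ℚ + ι n
ι-suc n rewrite normalize-coprime (Coprimality.sym (Coprimality.1-coprimeTo n)) =
  cong (_/ 1) (sym (cong (ℤ._+_ (ℤ.+ 1)) (ℤ.*-identityʳ (ℤ.+ n))))

ι-+ : ∀ m n → ι (m ℕ.+ n) ≡ ι m + ι n
ι-+ zero    n = sym (+-identityˡ (ι n))
ι-+ (suc m) n rewrite ι-suc (m ℕ.+ n) | ι-+ m n | ι-suc m = sym (+-assoc 1ℚ (ι m) (ι n))

ι-* : ∀ m n → ι (m ℕ.* n) ≡ ι m * ι n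
ι-* zero    n = sym (*-zeroˡ (ι n))
ι-* (suc m) n rewrite ι-+ n (m ℕ.* n) | ι-* m n | ι-suc m =
  solve 2 (λ a b → b :+ a :* b := (con 1ℚ :+ a) :* b) refl (ι m) (ι n)
  where open ℚ-Solver

[k+1]*[n+1]C[k+1]≡[n+1]*nCk : ∀ n k → suc k ℕ.* (suc n C suc k) ≡ suc n ℕ.* (n C k)
[k+1]*[n+1]C[k+1]≡[n+1]*nCk zero    zero    = refl
[k+1]*[n+1]C[k+1]≡[n+1]*nCk zero    (suc k) = ℕ.*-zeroʳ (suc (suc k))
[k+1]*[n+1]C[k+1]≡[n+1]*nCk (suc n) zero    = trans (ℕ.*-identityˡ _) (trans (nC1≡n (suc (suc n))) (sym (ℕ.*-identityʳ _)))
[k+1]*[n+1]C[k+1]≡[n+1]*nCk (suc n) (suc k) = begin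
  suc (suc k) ℕ.* (suc (suc n) C suc (suc k))
    ≡⟨ cong (suc (suc k) ℕ.*_) (sym (nCk+nC[k+1]≡[n+1]C[k+1] (suc n) (suc k))) ⟩
  suc (suc k) ℕ.* (x ℕ.+ y)
    ≡⟨ solve 3 (λ k x y → (con 2 :+ k) :* (x :+ y) := x :+ (con 1 :+ k) :* x :+ (con 2 :+ k) :* y) refl k x y ⟩
  x ℕ.+ suc k ℕ.* x ℕ.+ suc (suc k) ℕ.* y
    ≡⟨ cong₂ (λ u v → x ℕ.+ u ℕ.+ v) ([k+1]*[n+1]C[k+1]≡[n+1]*nCk n k) ([k+1]*[n+1]C[k+1]≡[n+1]*nCk n (suc k)) ⟩
  x ℕ.+ suc n ℕ.* (n C k) ℕ.+ suc n ℕ.* (n C suc k)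
    ≡⟨ solve 4 (λ n x u v → x :+ (con 1 :+ n) :* u :+ (con 1 :+ n) :* v := x :+ (con 1 :+ n) :* (u :+ v)) refl n x (n C k) (n C suc k) ⟩
  x ℕ.+ suc n ℕ.* (n C k ℕ.+ n C suc k)
    ≡⟨ cong (λ z → x ℕ.+ suc n ℕ.* z) (nCk+nC[k+1]≡[n+1]C[k+1] n k) ⟩
  suc (suc n) ℕ.* x
    ∎
  where
  open ≡-Reasoning
  open ℕ-Solver
  x = suc n C suc k
  y = suc n C suc (suc k)

[k+1]*nC[k+1]+k*nCk≡n*nCk : ∀ n k → suc k ℕ.* (n C suc k) ℕ.+ k ℕ.* (n C k) ≡ n ℕ.* (n C k)
[k+1]*nC[k+1]+k*nCk≡n*nCk zero    zero    = refl
[k+1]*nC[k+1]+k*nCk≡n*nCk zero    (suc k) = cong₂ ℕ._+_ (ℕ.*-zeroʳ (suc (suc k))) (ℕ.*-zeroʳ (suc k))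
[k+1]*nC[k+1]+k*nCk≡n*nCk (suc n) zero    = trans (ℕ.+-identityʳ _) ([k+1]*[n+1]C[k+1]≡[n+1]*nCk n 0)
[k+1]*nC[k+1]+k*nCk≡n*nCk (suc n) (suc k) = begin
  suc (suc k) ℕ.* (suc n C suc (suc k)) ℕ.+ suc k ℕ.* (suc n C suc k)
    ≡⟨ cong₂ ℕ._+_ ([k+1]*[n+1]C[k+1]≡[n+1]*nCk n (suc k)) ([k+1]*[n+1]C[k+1]≡[n+1]*nCk n k) ⟩
  suc n ℕ.* (n C suc k) ℕ.+ suc n ℕ.* (n C k)
    ≡⟨ trans (ℕ.+-comm (suc n ℕ.* (n C suc k)) _) (sym (ℕ.*-distribˡ-+ (suc n) (n C k) (n C suc k))) ⟩
  suc n ℕ.* (n C k ℕ.+ n C suc k)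
    ≡⟨ cong (suc n ℕ.*_) (nCk+nC[k+1]≡[n+1]C[k+1] n k) ⟩
  suc n ℕ.* (suc n C suc k)
    ∎
  where open ≡-Reasoning

[k+1]*nC[k+1]+m*nCk≡[l+1]*nCk : ∀ k l n m → n ℕ.+ m ≡ suc (k ℕ.+ l) →
  suc k ℕ.* (n C suc k) ℕ.+ m ℕ.* (n C k) ≡ suc l ℕ.* (n C k)
[k+1]*nC[k+1]+m*nCk≡[l+1]*nCk k l n m n+m≡ = ℕ.+-cancelʳ-≡ (k ℕ.* x) (suc k ℕ.* (n C suc k) ℕ.+ m ℕ.* x) (suc l ℕ.* x) (begin
  suc k ℕ.* (n C suc k) ℕ.+ m ℕ.* x ℕ.+ k ℕ.* x
    ≡⟨ solve 4 (λ u m x kx → u :+ m :* x :+ kx := u :+ kx :+ m :* x) refl (suc k ℕ.* (n C suc k)) m x (k ℕ.* x) ⟩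
  suc k ℕ.* (n C suc k) ℕ.+ k ℕ.* x ℕ.+ m ℕ.* x
    ≡⟨ cong (ℕ._+ m ℕ.* x) ([k+1]*nC[k+1]+k*nCk≡n*nCk n k) ⟩
  n ℕ.* x ℕ.+ m ℕ.* x
    ≡⟨ sym (ℕ.*-distribʳ-+ x n m) ⟩
  (n ℕ.+ m) ℕ.* x
    ≡⟨ cong (ℕ._* x) n+m≡ ⟩
  suc (k ℕ.+ l) ℕ.* x
    ≡⟨ solve 3 (λ k l x → (con 1 :+ (k :+ l)) :* x := (con 1 :+ l) :* x :+ k :* x) refl k l x ⟩
  suc l ℕ.* x ℕ.+ k ℕ.* x
    ∎)
  where
  open ≡-Reasoning
  open ℕ-Solver
  x = n C k

[n+1-k]*[n+1]Ck≡[n+1]*nCk : ∀ k l → suc l ℕ.* (suc (k ℕ.+ l) C k) ≡ suc (k ℕ.+ l) ℕ.* ((k ℕ.+ l) C k)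
[n+1-k]*[n+1]Ck≡[n+1]*nCk k l = begin
  suc l ℕ.* (suc (k ℕ.+ l) C k)                           ≡⟨ sym ([k+1]*nC[k+1]+m*nCk≡[l+1]*nCk k l (suc (k ℕ.+ l)) 0 (ℕ.+-identityʳ _)) ⟩
  suc k ℕ.* (suc (k ℕ.+ l) C suc k) ℕ.+ 0                 ≡⟨ ℕ.+-identityʳ _ ⟩
  suc k ℕ.* (suc (k ℕ.+ l) C suc k)                       ≡⟨ [k+1]*[n+1]C[k+1]≡[n+1]*nCk (k ℕ.+ l) k ⟩
  suc (k ℕ.+ l) ℕ.* ((k ℕ.+ l) C k)                       ∎
  where open ≡-Reasoning

altC : ℕ → ℕ → ℚ
altC d e = ι (d C e) * sgn (d ∸ e)

sgn-cancel : ∀ {d e} → e < d → sgn (d ∸ e) + sgn (d ∸ suc e) ≡ 0ℚ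
sgn-cancel {suc d} {zero}  _         = +-inverseˡ (sgn d)
sgn-cancel {suc d} {suc e} (s≤s e<d) = sgn-cancel e<d

altC-pascal : ∀ d e → altC (suc d) (suc e) + altC d (suc e) ≡ altC d e
altC-pascal d e = begin
  ι (suc d C suc e) * sgn (d ∸ e) + ι (d C suc e) * sgn (d ∸ suc e)
    ≡⟨ cong (λ z → z * sgn (d ∸ e) + ι (d C suc e) * sgn (d ∸ suc e))
            (trans (cong ι (sym (nCk+nC[k+1]≡[n+1]C[k+1] d e))) (ι-+ (d C e) (d C suc e))) ⟩
  (ι (d C e) + ι (d C suc e)) * sgn (d ∸ e) + ι (d C suc e) * sgn (d ∸ suc e)
    ≡⟨ solve 4 (λ x y u v → (x :+ y) :* u :+ y :* v := x :* u :+ y :* (u :+ v)) refl (ι (d C e)) (ι (d C suc e)) (sgn (d ∸ e)) (sgn (d ∸ suc e)) ⟩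
  altC d e + ι (d C suc e) * (sgn (d ∸ e) + sgn (d ∸ suc e))
    ≡⟨ cong (λ z → altC d e + z) vanishing ⟩
  altC d e + 0ℚ
    ≡⟨ +-identityʳ (altC d e) ⟩
  altC d e
    ∎
  where
  open ≡-Reasoning
  open ℚ-Solver
  vanishing : ι (d C suc e) * (sgn (d ∸ e) + sgn (d ∸ suc e)) ≡ 0ℚ
  vanishing with e ℕ.<? d
  ... | yes e<d = trans (cong (ι (d C suc e) *_) (sgn-cancel e<d)) (*-zeroʳ (ι (d C suc e)))
  ... | no  e≮d rewrite k>n⇒nCk≡0 (s≤s (ℕ.≮⇒≥ e≮d)) = *-zeroˡ (sgn (d ∸ e) + sgn (d ∸ suc e))

altC-zero : ∀ d → altC (suc d) 0 + altC d 0 ≡ 0ℚ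
altC-zero d = trans (cong (_+ altC d 0) (sym (neg-distribʳ-* (ι 1) (sgn d)))) (+-inverseˡ (altC d 0))

altC-vanish : ∀ {d e} → d < e → altC d e ≡ 0ℚ
altC-vanish {d} {e} d<e rewrite k>n⇒nCk≡0 d<e = *-zeroˡ (sgn (d ∸ e))

fromℚᵘ-+ : ∀ p q → fromℚᵘ (p ℚᵘ.+ q) ≡ fromℚᵘ p + fromℚᵘ q
fromℚᵘ-+ p q = toℚᵘ-injective (ℚᵘ.≃-trans (toℚᵘ-fromℚᵘ (p ℚᵘ.+ q))
  (ℚᵘ.≃-sym (ℚᵘ.≃-trans (toℚᵘ-homo-+ (fromℚᵘ p) (fromℚᵘ q)) (ℚᵘ.+-cong (toℚᵘ-fromℚᵘ p) (toℚᵘ-fromℚᵘ q)))))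

/-split : ∀ a b c n m .{{_ : NonZero n}} .{{_ : NonZero m}} →
  a ℕ.* m ≡ (b ℕ.+ c) ℕ.* n → ℤ.+ a / n ≡ ℤ.+ b / m + ℤ.+ c / m
/-split a b c (suc n) (suc m) a*m≡ =
  trans (fromℚᵘ-cong {ℚᵘ.mkℚᵘ (ℤ.+ a) n} {ℚᵘ.mkℚᵘ (ℤ.+ b) m ℚᵘ.+ ℚᵘ.mkℚᵘ (ℤ.+ c) m} (ℚᵘ.*≡* crossℤ))
        (fromℚᵘ-+ (ℚᵘ.mkℚᵘ (ℤ.+ b) m) (ℚᵘ.mkℚᵘ (ℤ.+ c) m))
  where
  open ℕ-Solver
  cross : a ℕ.* (suc m ℕ.* suc m) ≡ (b ℕ.* suc m ℕ.+ c ℕ.* suc m) ℕ.* suc n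
  cross = begin
    a ℕ.* (suc m ℕ.* suc m)                ≡⟨ sym (ℕ.*-assoc a (suc m) (suc m)) ⟩
    a ℕ.* suc m ℕ.* suc m                  ≡⟨ cong (ℕ._* suc m) a*m≡ ⟩
    (b ℕ.+ c) ℕ.* suc n ℕ.* suc m          ≡⟨ solve 4 (λ b c n m → (b :+ c) :* n :* m := (b :* m :+ c :* m) :* n) refl b c (suc n) (suc m) ⟩
    (b ℕ.* suc m ℕ.+ c ℕ.* suc m) ℕ.* suc n  ∎
    where open ≡-Reasoning
  crossℤ : ℤ.+ a ℤ.* ℤ.+ (suc m ℕ.* suc m) ≡ (ℤ.+ b ℤ.* ℤ.+ suc m ℤ.+ ℤ.+ c ℤ.* ℤ.+ suc m) ℤ.* ℤ.+ suc n
  crossℤ = trans (sym (ℤ.pos-* a (suc m ℕ.* suc m))) (trans (cong ℤ.+_ cross)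
             (trans (ℤ.pos-* (b ℕ.* suc m ℕ.+ c ℕ.* suc m) (suc n))
                    (cong (ℤ._* ℤ.+ suc n) (trans (ℤ.pos-+ (b ℕ.* suc m) (c ℕ.* suc m))
                                                    (cong₂ ℤ._+_ (ℤ.pos-* b (suc m)) (ℤ.pos-* c (suc m)))))))

factQuot-rec : ∀ d₁ d₂ → factQuot d₁ d₂ ≡ factQuot (suc d₁) d₂ + factQuot d₁ (suc d₂)
factQuot-rec d₁ d₂ =
  trans (/-split (d₁ ! ℕ.* d₂ !) (suc d₁ ! ℕ.* d₂ !) (d₁ ! ℕ.* suc d₂ !) (suc D !) (suc (suc D) !) {{suc D !≢0}} {{suc (suc D) !≢0}} cross)
        (cong (factQuot (suc d₁) d₂ +_) (/-cong {ℤ.+ (d₁ ! ℕ.* suc d₂ !)} {_} {ℤ.+ (d₁ ! ℕ.* suc d₂ !)}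
                                               {{suc (suc D) !≢0}} {{suc (d₁ ℕ.+ suc d₂) !≢0}} refl (cong (λ x → suc x !) (sym (ℕ.+-suc d₁ d₂)))))
  where
  open ℕ-Solver
  D = d₁ ℕ.+ d₂
  cross : d₁ ! ℕ.* d₂ ! ℕ.* suc (suc D) ! ≡ (suc d₁ ! ℕ.* d₂ ! ℕ.+ d₁ ! ℕ.* suc d₂ !) ℕ.* suc D !
  cross = solve 5 (λ d₁ d₂ x y z → x :* y :* ((con 2 :+ (d₁ :+ d₂)) :* z) := ((con 1 :+ d₁) :* x :* y :+ x :* ((con 1 :+ d₂) :* y)) :* z)
                refl d₁ d₂ (d₁ !) (d₂ !) (suc D !)

G₁-coeff-rec : ∀ a₁ a₂ d₁ d₂ →
  factQuot d₁ d₂ * ι ((a₁ ℕ.+ a₂) C a₁) * ι (suc (a₁ ℕ.+ a₂)) ≡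
  ι (suc a₁) * (factQuot (suc d₁) d₂ * ι (suc (a₁ ℕ.+ a₂) C suc a₁)) + ι (suc a₂) * (factQuot d₁ (suc d₂) * ι (suc (a₁ ℕ.+ a₂) C a₁))
G₁-coeff-rec a₁ a₂ d₁ d₂ = begin
  factQuot d₁ d₂ * y * ι (suc n)
    ≡⟨ cong (λ z → z * y * ι (suc n)) (factQuot-rec d₁ d₂) ⟩
  (F₁ + F₂) * y * ι (suc n)
    ≡⟨ solve 4 (λ F₁ F₂ y S → (F₁ :+ F₂) :* y :* S := F₁ :* (S :* y) :+ F₂ :* (S :* y)) refl F₁ F₂ y (ι (suc n)) ⟩
  F₁ * (ι (suc n) * y) + F₂ * (ι (suc n) * y)
    ≡⟨ cong₂ (λ u v → F₁ * u + F₂ * v) (lift (suc a₁) (suc n C suc a₁) ([k+1]*[n+1]C[k+1]≡[n+1]*nCk n a₁))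
                                          (lift (suc a₂) (suc n C a₁) ([n+1-k]*[n+1]Ck≡[n+1]*nCk a₁ a₂)) ⟩
  F₁ * (ι (suc a₁) * ι (suc n C suc a₁)) + F₂ * (ι (suc a₂) * ι (suc n C a₁))
    ≡⟨ solve 6 (λ F₁ F₂ A₁ x A₂ z → F₁ :* (A₁ :* x) :+ F₂ :* (A₂ :* z) := A₁ :* (F₁ :* x) :+ A₂ :* (F₂ :* z))
             refl F₁ F₂ (ι (suc a₁)) (ι (suc n C suc a₁)) (ι (suc a₂)) (ι (suc n C a₁)) ⟩
  ι (suc a₁) * (F₁ * ι (suc n C suc a₁)) + ι (suc a₂) * (F₂ * ι (suc n C a₁))
    ∎
  where
  open ≡-Reasoning
  open ℚ-Solver
  n = a₁ ℕ.+ a₂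
  y = ι (n C a₁)
  F₁ = factQuot (suc d₁) d₂
  F₂ = factQuot d₁ (suc d₂)
  lift : ∀ u v → u ℕ.* v ≡ suc n ℕ.* (n C a₁) → ι (suc n) * y ≡ ι u * ι v
  lift u v eq = trans (sym (ι-* (suc n) (n C a₁))) (trans (cong ι (sym eq)) (ι-* u v))

-- Formal linear combinations

η : Sym → Lin
η t = (1ℚ , t) ∷ []

coeff-η : ∀ s t q → (if s == t then q else 0ℚ) ≡ q * coeff s (η t)
coeff-η s t q = trans (ite (s == t)) (cong (q *_) (sym (+-identityʳ (if s == t then 1ℚ else 0ℚ))))
  where
  ite : ∀ b → (if b then q else 0ℚ) ≡ q * (if b then 1ℚ else 0ℚ)
  ite true  = sym (*-identityʳ q)
  ite false = sym (*-zeroʳ q)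

coeff-singleton : ∀ s q t → coeff s ((q , t) ∷ []) ≡ q * coeff s (η t)
coeff-singleton s q t = trans (+-identityʳ (if s == t then q else 0ℚ)) (coeff-η s t q)

coeff-++ : ∀ s v w → coeff s (v ++ w) ≡ coeff s v + coeff s w
coeff-++ s []            w = sym (+-identityˡ _)
coeff-++ s ((q , t) ∷ v) w =
  trans (cong (x +_) (coeff-++ s v w)) (sym (+-assoc x (coeff s v) (coeff s w)))
  where x = if s == t then q else 0ℚ

coeff-scale : ∀ s p v → coeff s (scale p v) ≡ p * coeff s v
coeff-scale s p []            = sym (*-zeroʳ p)
coeff-scale s p ((q , t) ∷ v) = begin
  (if s == t then p * q else 0ℚ) + coeff s (scale p v)  ≡⟨ cong₂ _+_ (ite (s == t)) (coeff-scale s p v) ⟩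
  p * (if s == t then q else 0ℚ) + p * coeff s v        ≡⟨ sym (*-distribˡ-+ p _ _) ⟩
  p * coeff s ((q , t) ∷ v)                             ∎
  where
  open ≡-Reasoning
  ite : ∀ b → (if b then p * q else 0ℚ) ≡ p * (if b then q else 0ℚ)
  ite true  = refl
  ite false = sym (*-zeroʳ p)

coeff-extend-∷ : ∀ s f q t v → coeff s (extend f ((q , t) ∷ v)) ≡ q * coeff s (f t) + coeff s (extend f v)
coeff-extend-∷ s f q t v =
  trans (coeff-++ s (scale q (f t)) (extend f v)) (cong (_+ coeff s (extend f v)) (coeff-scale s q (f t)))

coeff-extend-++ : ∀ s f v w → coeff s (extend f (v ++ w)) ≡ coeff s (extend f v) + coeff s (extend f w)
coeff-extend-++ s f v w = trans (cong (coeff s) (concatMap-++ _ v w)) (coeff-++ s (extend f v) (extend f w))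

coeff-extend-scale : ∀ s f p v → coeff s (extend f (scale p v)) ≡ p * coeff s (extend f v)
coeff-extend-scale s f p []            = sym (*-zeroʳ p)
coeff-extend-scale s f p ((q , t) ∷ v) = begin
  coeff s (extend f ((p * q , t) ∷ scale p v))            ≡⟨ coeff-extend-∷ s f (p * q) t (scale p v) ⟩
  p * q * coeff s (f t) + coeff s (extend f (scale p v))  ≡⟨ cong (p * q * coeff s (f t) +_) (coeff-extend-scale s f p v) ⟩
  p * q * coeff s (f t) + p * coeff s (extend f v)
    ≡⟨ solve 4 (λ p q x y → p :* q :* x :+ p :* y := p :* (q :* x :+ y)) refl p q (coeff s (f t)) (coeff s (extend f v)) ⟩
  p * (q * coeff s (f t) + coeff s (extend f v))          ≡⟨ cong (p *_) (sym (coeff-extend-∷ s f q t v)) ⟩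
  p * coeff s (extend f ((q , t) ∷ v))                    ∎
  where
  open ≡-Reasoning
  open ℚ-Solver

coeff-extend-η : ∀ s v → coeff s (extend η v) ≡ coeff s v
coeff-extend-η s []            = refl
coeff-extend-η s ((q , t) ∷ v) = begin
  coeff s (extend η ((q , t) ∷ v))         ≡⟨ coeff-extend-∷ s η q t v ⟩
  q * coeff s (η t) + coeff s (extend η v) ≡⟨ cong₂ _+_ (sym (coeff-η s t q)) (coeff-extend-η s v) ⟩
  coeff s ((q , t) ∷ v)                    ∎
  where open ≡-Reasoning

coeff-extend-singleton : ∀ s f q t → coeff s (extend f ((q , t) ∷ [])) ≡ q * coeff s (f t)
coeff-extend-singleton s f q t = trans (coeff-extend-∷ s f q t []) (+-identityʳ (q * coeff s (f t)))

coeff-extend-unit : ∀ s f t → coeff s (extend f (η t)) ≡ coeff s (f t)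
coeff-extend-unit s f t = trans (coeff-extend-singleton s f 1ℚ t) (*-identityˡ (coeff s (f t)))

-- Sums

∑< : ℕ → (ℕ → ℚ) → ℚ
∑< zero    g = 0ℚ
∑< (suc n) g = g 0 + ∑< n (g ∘ suc)

coeff-extend-concatMap : ∀ s f (F : ℕ → Lin) g n →
  coeff s (extend f (concatMap F (applyUpTo g n))) ≡ ∑< n (λ i → coeff s (extend f (F (g i))))
coeff-extend-concatMap s f F g zero    = refl
coeff-extend-concatMap s f F g (suc n) =
  trans (coeff-extend-++ s f (F (g 0)) (concatMap F (applyUpTo (g ∘ suc) n)))
        (cong (coeff s (extend f (F (g 0))) +_) (coeff-extend-concatMap s f F (g ∘ suc) n))

coeff-extend-map : ∀ s f (c : ℕ → ℚ) (h : ℕ → Sym) g n →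
  coeff s (extend f (map (λ x → (c x , h x)) (applyUpTo g n))) ≡ ∑< n (λ i → c (g i) * coeff s (f (h (g i))))
coeff-extend-map s f c h g zero    = refl
coeff-extend-map s f c h g (suc n) =
  trans (coeff-extend-∷ s f (c (g 0)) (h (g 0)) (map (λ x → (c x , h x)) (applyUpTo (g ∘ suc) n)))
        (cong (c (g 0) * coeff s (f (h (g 0))) +_) (coeff-extend-map s f c h (g ∘ suc) n))

-- Σ⟨ n ⟩ g is the sum of g i j over i + j = n.
Σ⟨_⟩ : ℕ → (ℕ → ℕ → ℚ) → ℚ
Σ⟨ zero  ⟩ g = g 0 0
Σ⟨ suc n ⟩ g = g 0 (suc n) + Σ⟨ n ⟩ (λ i j → g (suc i) j)

∑<-antidiagonal : ∀ n (g : ℕ → ℕ → ℚ) → ∑< (suc n) (λ i → g i (n ∸ i)) ≡ Σ⟨ n ⟩ g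
∑<-antidiagonal zero    g = +-identityʳ (g 0 0)
∑<-antidiagonal (suc n) g = cong (g 0 (suc n) +_) (∑<-antidiagonal n (λ i j → g (suc i) j))

∑<-antidiagonal-suc : ∀ n (g : ℕ → ℕ → ℚ) → ∑< (suc n) (λ i → g i (suc n ∸ i)) ≡ Σ⟨ n ⟩ (λ i j → g i (suc j))
∑<-antidiagonal-suc zero    g = +-identityʳ (g 0 1)
∑<-antidiagonal-suc (suc n) g = cong (g 0 (suc (suc n)) +_) (∑<-antidiagonal-suc n (λ i j → g (suc i) j))

Σ-snoc : ∀ n (g : ℕ → ℕ → ℚ) → Σ⟨ suc n ⟩ g ≡ Σ⟨ n ⟩ (λ i j → g i (suc j)) + g (suc n) 0
Σ-snoc zero    g = refl
Σ-snoc (suc n) g = begin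
  g 0 (suc (suc n)) + Σ⟨ suc n ⟩ (λ i j → g (suc i) j)
    ≡⟨ cong (g 0 (suc (suc n)) +_) (Σ-snoc n (λ i j → g (suc i) j)) ⟩
  g 0 (suc (suc n)) + (Σ⟨ n ⟩ (λ i j → g (suc i) (suc j)) + g (suc (suc n)) 0)
    ≡⟨ sym (+-assoc (g 0 (suc (suc n))) (Σ⟨ n ⟩ (λ i j → g (suc i) (suc j))) (g (suc (suc n)) 0)) ⟩
  Σ⟨ suc n ⟩ (λ i j → g i (suc j)) + g (suc (suc n)) 0
    ∎
  where open ≡-Reasoning

Σ-cong : ∀ n {g h : ℕ → ℕ → ℚ} → (∀ i j → i ℕ.+ j ≡ n → g i j ≡ h i j) → Σ⟨ n ⟩ g ≡ Σ⟨ n ⟩ h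
Σ-cong zero    g≡h = g≡h 0 0 refl
Σ-cong (suc n) g≡h =
  cong₂ _+_ (g≡h 0 (suc n) refl) (Σ-cong n (λ i j i+j≡n → g≡h (suc i) j (cong suc i+j≡n)))

Σ-+ : ∀ n (g h : ℕ → ℕ → ℚ) → Σ⟨ n ⟩ (λ i j → g i j + h i j) ≡ Σ⟨ n ⟩ g + Σ⟨ n ⟩ h
Σ-+ zero    g h = refl
Σ-+ (suc n) g h = begin
  g 0 (suc n) + h 0 (suc n) + Σ⟨ n ⟩ (λ i j → g (suc i) j + h (suc i) j)
    ≡⟨ cong (g 0 (suc n) + h 0 (suc n) +_) (Σ-+ n (λ i j → g (suc i) j) (λ i j → h (suc i) j)) ⟩
  g 0 (suc n) + h 0 (suc n) + (Σ⟨ n ⟩ (λ i j → g (suc i) j) + Σ⟨ n ⟩ (λ i j → h (suc i) j))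
    ≡⟨ solve 4 (λ a b x y → a :+ b :+ (x :+ y) := a :+ x :+ (b :+ y)) refl
         (g 0 (suc n)) (h 0 (suc n)) (Σ⟨ n ⟩ (λ i j → g (suc i) j)) (Σ⟨ n ⟩ (λ i j → h (suc i) j)) ⟩
  Σ⟨ suc n ⟩ g + Σ⟨ suc n ⟩ h
    ∎
  where
  open ≡-Reasoning
  open ℚ-Solver

Σ-* : ∀ n q (g : ℕ → ℕ → ℚ) → Σ⟨ n ⟩ (λ i j → q * g i j) ≡ q * Σ⟨ n ⟩ g
Σ-* zero    q g = refl
Σ-* (suc n) q g =
  trans (cong (q * g 0 (suc n) +_) (Σ-* n q (λ i j → g (suc i) j))) (sym (*-distribˡ-+ q (g 0 (suc n)) (Σ⟨ n ⟩ (λ i j → g (suc i) j))))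

Σ-0 : ∀ n → Σ⟨ n ⟩ (λ _ _ → 0ℚ) ≡ 0ℚ
Σ-0 zero    = refl
Σ-0 (suc n) = trans (+-identityˡ (Σ⟨ n ⟩ (λ _ _ → 0ℚ))) (Σ-0 n)

Σ-0* : ∀ n (g : ℕ → ℕ → ℚ) → Σ⟨ n ⟩ (λ i j → 0ℚ * g i j) ≡ 0ℚ
Σ-0* n g = trans (Σ-cong n (λ i j _ → *-zeroˡ (g i j))) (Σ-0 n)

Σ²⟨_,_⟩ : ℕ → ℕ → (ℕ → ℕ → ℕ → ℕ → ℚ) → ℚ
Σ²⟨ n , D ⟩ g = Σ⟨ n ⟩ (λ i j → Σ⟨ D ⟩ (g i j))

Σ²-cong : ∀ n D {g h : ℕ → ℕ → ℕ → ℕ → ℚ} →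
  (∀ i j e f → i ℕ.+ j ≡ n → e ℕ.+ f ≡ D → g i j e f ≡ h i j e f) → Σ²⟨ n , D ⟩ g ≡ Σ²⟨ n , D ⟩ h
Σ²-cong n D g≡h = Σ-cong n (λ i j i+j≡n → Σ-cong D (λ e f e+f≡D → g≡h i j e f i+j≡n e+f≡D))

Σ²-+ : ∀ n D (g h : ℕ → ℕ → ℕ → ℕ → ℚ) →
  Σ²⟨ n , D ⟩ (λ i j e f → g i j e f + h i j e f) ≡ Σ²⟨ n , D ⟩ g + Σ²⟨ n , D ⟩ h
Σ²-+ n D g h = trans (Σ-cong n (λ i j _ → Σ-+ D (g i j) (h i j))) (Σ-+ n _ _)

Σ²-* : ∀ n D q (g : ℕ → ℕ → ℕ → ℕ → ℚ) → Σ²⟨ n , D ⟩ (λ i j e f → q * g i j e f) ≡ q * Σ²⟨ n , D ⟩ g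
Σ²-* n D q g = trans (Σ-cong n (λ i j _ → Σ-* D q (g i j))) (Σ-* n q _)

Σ²-linear : ∀ n D p q (x y g : ℕ → ℕ → ℕ → ℕ → ℚ) →
  Σ²⟨ n , D ⟩ (λ i j e f → (p * x i j e f + q * y i j e f) * g i j e f) ≡
  p * Σ²⟨ n , D ⟩ (λ i j e f → x i j e f * g i j e f) + q * Σ²⟨ n , D ⟩ (λ i j e f → y i j e f * g i j e f)
Σ²-linear n D p q x y g = begin
  Σ²⟨ n , D ⟩ (λ i j e f → (p * x i j e f + q * y i j e f) * g i j e f)
    ≡⟨ Σ²-cong n D (λ i j e f _ _ → solve 5 (λ p q x y g → (p :* x :+ q :* y) :* g := p :* (x :* g) :+ q :* (y :* g))
                                            refl p q (x i j e f) (y i j e f) (g i j e f)) ⟩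
  Σ²⟨ n , D ⟩ (λ i j e f → p * (x i j e f * g i j e f) + q * (y i j e f * g i j e f))
    ≡⟨ Σ²-+ n D (λ i j e f → p * (x i j e f * g i j e f)) (λ i j e f → q * (y i j e f * g i j e f)) ⟩
  Σ²⟨ n , D ⟩ (λ i j e f → p * (x i j e f * g i j e f)) + Σ²⟨ n , D ⟩ (λ i j e f → q * (y i j e f * g i j e f))
    ≡⟨ cong₂ _+_ (Σ²-* n D p (λ i j e f → x i j e f * g i j e f)) (Σ²-* n D q (λ i j e f → y i j e f * g i j e f)) ⟩
  p * Σ²⟨ n , D ⟩ (λ i j e f → x i j e f * g i j e f) + q * Σ²⟨ n , D ⟩ (λ i j e f → y i j e f * g i j e f)
    ∎
  where
  open ≡-Reasoning
  open ℚ-Solver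

shift₁ : (ℕ → ℕ → ℕ → ℕ → ℚ) → ℕ → ℕ → ℕ → ℕ → ℚ
shift₁ φ zero    j e       f = 0ℚ
shift₁ φ (suc i) j zero    f = 0ℚ
shift₁ φ (suc i) j (suc e) f = φ i j e f

shift₂ : (ℕ → ℕ → ℕ → ℕ → ℚ) → ℕ → ℕ → ℕ → ℕ → ℚ
shift₂ φ i zero    e f       = 0ℚ
shift₂ φ i (suc j) e zero    = 0ℚ
shift₂ φ i (suc j) e (suc f) = φ i j e f

Σ²-shift₁ : ∀ n D (φ g : ℕ → ℕ → ℕ → ℕ → ℚ) →
  Σ²⟨ suc n , suc D ⟩ (λ i j e f → shift₁ φ i j e f * g i j e f) ≡
  Σ²⟨ n , D ⟩ (λ i j e f → φ i j e f * g (suc i) j (suc e) f)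
Σ²-shift₁ n D φ g = begin
  Σ⟨ suc D ⟩ (λ e f → 0ℚ * g 0 (suc n) e f) + Σ⟨ n ⟩ (λ i j → Σ⟨ suc D ⟩ (λ e f → shift₁ φ (suc i) j e f * g (suc i) j e f))
    ≡⟨ cong₂ _+_ (Σ-0* (suc D) (g 0 (suc n))) (Σ-cong n (λ i j _ → row i j)) ⟩
  0ℚ + Σ²⟨ n , D ⟩ (λ i j e f → φ i j e f * g (suc i) j (suc e) f)
    ≡⟨ +-identityˡ _ ⟩
  Σ²⟨ n , D ⟩ (λ i j e f → φ i j e f * g (suc i) j (suc e) f)
    ∎
  where
  open ≡-Reasoning
  row : ∀ i j → Σ⟨ suc D ⟩ (λ e f → shift₁ φ (suc i) j e f * g (suc i) j e f) ≡
                Σ⟨ D ⟩ (λ e f → φ i j e f * g (suc i) j (suc e) f)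
  row i j = trans (cong (_+ Σ⟨ D ⟩ (λ e f → φ i j e f * g (suc i) j (suc e) f)) (*-zeroˡ (g (suc i) j 0 (suc D))))
                  (+-identityˡ _)

Σ²-shift₂ : ∀ n D (φ g : ℕ → ℕ → ℕ → ℕ → ℚ) →
  Σ²⟨ suc n , suc D ⟩ (λ i j e f → shift₂ φ i j e f * g i j e f) ≡
  Σ²⟨ n , D ⟩ (λ i j e f → φ i j e f * g i (suc j) e (suc f))
Σ²-shift₂ n D φ g = begin
  Σ⟨ suc n ⟩ (λ i j → Σ⟨ suc D ⟩ (λ e f → shift₂ φ i j e f * g i j e f))
    ≡⟨ Σ-snoc n (λ i j → Σ⟨ suc D ⟩ (λ e f → shift₂ φ i j e f * g i j e f)) ⟩
  Σ⟨ n ⟩ (λ i j → Σ⟨ suc D ⟩ (λ e f → shift₂ φ i (suc j) e f * g i (suc j) e f)) + Σ⟨ suc D ⟩ (λ e f → 0ℚ * g (suc n) 0 e f)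
    ≡⟨ cong₂ _+_ (Σ-cong n (λ i j _ → row i j)) (Σ-0* (suc D) (g (suc n) 0)) ⟩
  Σ²⟨ n , D ⟩ (λ i j e f → φ i j e f * g i (suc j) e (suc f)) + 0ℚ
    ≡⟨ +-identityʳ _ ⟩
  Σ²⟨ n , D ⟩ (λ i j e f → φ i j e f * g i (suc j) e (suc f))
    ∎
  where
  open ≡-Reasoning
  row : ∀ i j → Σ⟨ suc D ⟩ (λ e f → shift₂ φ i (suc j) e f * g i (suc j) e f) ≡
                Σ⟨ D ⟩ (λ e f → φ i j e f * g i (suc j) e (suc f))
  row i j = trans (Σ-snoc D (λ e f → shift₂ φ i (suc j) e f * g i (suc j) e f))
                  (trans (cong (Σ⟨ D ⟩ (λ e f → φ i j e f * g i (suc j) e (suc f)) +_) (*-zeroˡ (g i (suc j) (suc D) 0)))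
                         (+-identityʳ _))

-- The Leibniz rule for both sides of the relations

-- With k₁ = a₁+1, k₂ = a₂+1 and l₁ = i+1, shuffleCoeff a₁ a₂ d₁ d₂ i e is the coefficient
-- of G[l₁,l₂;e,e₂] in the shuffle side of P[k₁,k₂;d₁,d₂].
term : ℕ → ℕ → ℕ → ℕ → ℚ
term a d i e = ι (i C a) * altC d e

shuffleCoeff : ℕ → ℕ → ℕ → ℕ → ℕ → ℕ → ℚ
shuffleCoeff a₁ a₂ d₁ d₂ i e = term a₁ d₁ i e + term a₂ d₂ i e

ι-C-*-sgn : ∀ a d i e → ι ((i C a) ℕ.* (d C e)) * sgn (d ∸ e) ≡ term a d i e
ι-C-*-sgn a d i e = trans (cong (_* sgn (d ∸ e)) (ι-* (i C a) (d C e))) (*-assoc (ι (i C a)) (ι (d C e)) (sgn (d ∸ e)))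

coeff-extend-shuffleSide : ∀ s f a₁ a₂ d₁ d₂ {n D} → a₁ ℕ.+ a₂ ≡ n → d₁ ℕ.+ d₂ ≡ D →
  coeff s (extend f (shuffleSide (suc a₁) (suc a₂) d₁ d₂)) ≡
  Σ²⟨ n , D ⟩ (λ i j e e′ → shuffleCoeff a₁ a₂ d₁ d₂ i e * coeff s (f (G₂ (suc i) (suc j) e e′)))
    + factQuot d₁ d₂ * ι (n C a₁) * coeff s (f (G₁ (suc n) (suc D)))
coeff-extend-shuffleSide s f a₁ a₂ d₁ d₂ refl refl = begin
  coeff s (extend f (grid m₀ ++ (T m₀ , G₁ m₀ (suc D)) ∷ []))
    ≡⟨ coeff-extend-++ s f (grid m₀) ((T m₀ , G₁ m₀ (suc D)) ∷ []) ⟩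
  coeff s (extend f (grid m₀)) + coeff s (extend f ((T m₀ , G₁ m₀ (suc D)) ∷ []))
    ≡⟨ cong₂ _+_ (coeff-extend-concatMap s f (λ i → row i (m₀ ∸ i)) (λ i → i) m₀) (coeff-extend-singleton s f (T m₀) (G₁ m₀ (suc D))) ⟩
  S m₀
    ≡⟨ cong S (ℕ.+-suc a₁ a₂) ⟩
  S (suc n)
    ≡⟨ cong (_+ T (suc n) * coeff s (f (G₁ (suc n) (suc D)))) gridSum ⟩
  Σ²⟨ n , D ⟩ (λ i j e e′ → shuffleCoeff a₁ a₂ d₁ d₂ i e * coeff s (f (G₂ (suc i) (suc j) e e′)))
    + factQuot d₁ d₂ * ι (n C a₁) * coeff s (f (G₁ (suc n) (suc D)))
    ∎
  where
  open ≡-Reasoning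
  n = a₁ ℕ.+ a₂
  D = d₁ ℕ.+ d₂
  m₀ = a₁ ℕ.+ suc a₂
  c : ℕ → ℕ → ℚ
  c i e = ι ((i C a₁) ℕ.* (d₁ C e)) * sgn (d₁ ∸ e) + ι ((i C a₂) ℕ.* (d₂ C e)) * sgn (d₂ ∸ e)
  row : ℕ → ℕ → Lin
  row i j = map (λ e → (c i e , G₂ (suc i) j e (D ∸ e))) (upTo (suc D))
  grid : ℕ → Lin
  grid m = concatMap (λ i → row i (m ∸ i)) (upTo m)
  T : ℕ → ℚ
  T m = factQuot d₁ d₂ * ι ((m ∸ 1) C a₁)
  S : ℕ → ℚ
  S m = ∑< m (λ i → coeff s (extend f (row i (m ∸ i)))) + T m * coeff s (f (G₁ m (suc D)))
  rowSum : ∀ i j → coeff s (extend f (row i j)) ≡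
                   Σ⟨ D ⟩ (λ e e′ → shuffleCoeff a₁ a₂ d₁ d₂ i e * coeff s (f (G₂ (suc i) j e e′)))
  rowSum i j = begin
    coeff s (extend f (row i j))
      ≡⟨ coeff-extend-map s f (c i) (λ e → G₂ (suc i) j e (D ∸ e)) (λ e → e) (suc D) ⟩
    ∑< (suc D) (λ e → c i e * coeff s (f (G₂ (suc i) j e (D ∸ e))))
      ≡⟨ ∑<-antidiagonal D (λ e e′ → c i e * coeff s (f (G₂ (suc i) j e e′))) ⟩
    Σ⟨ D ⟩ (λ e e′ → c i e * coeff s (f (G₂ (suc i) j e e′)))
      ≡⟨ Σ-cong D (λ e e′ _ → cong (_* coeff s (f (G₂ (suc i) j e e′))) (cong₂ _+_ (ι-C-*-sgn a₁ d₁ i e) (ι-C-*-sgn a₂ d₂ i e))) ⟩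
    Σ⟨ D ⟩ (λ e e′ → shuffleCoeff a₁ a₂ d₁ d₂ i e * coeff s (f (G₂ (suc i) j e e′)))
      ∎
  gridSum : ∑< (suc n) (λ i → coeff s (extend f (row i (suc n ∸ i)))) ≡
            Σ²⟨ n , D ⟩ (λ i j e e′ → shuffleCoeff a₁ a₂ d₁ d₂ i e * coeff s (f (G₂ (suc i) (suc j) e e′)))
  gridSum = trans (∑<-antidiagonal-suc n (λ i j → coeff s (extend f (row i j)))) (Σ-cong n (λ i j _ → rowSum i (suc j)))

coeff-shuffleSide : ∀ s a₁ a₂ d₁ d₂ {n D} → a₁ ℕ.+ a₂ ≡ n → d₁ ℕ.+ d₂ ≡ D →
  coeff s (shuffleSide (suc a₁) (suc a₂) d₁ d₂) ≡
  Σ²⟨ n , D ⟩ (λ i j e e′ → shuffleCoeff a₁ a₂ d₁ d₂ i e * coeff s (η (G₂ (suc i) (suc j) e e′)))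
    + factQuot d₁ d₂ * ι (n C a₁) * coeff s (η (G₁ (suc n) (suc D)))
coeff-shuffleSide s a₁ a₂ d₁ d₂ n≡ D≡ =
  trans (sym (coeff-extend-η s (shuffleSide (suc a₁) (suc a₂) d₁ d₂))) (coeff-extend-shuffleSide s η a₁ a₂ d₁ d₂ n≡ D≡)

-- The coefficient of G[i+1,j+1;e,f] in ∂ (Σ c(i,e) G[i+1,j+1;e,f]) is
-- ∂coeff₁ c i j e f + ∂coeff₂ c i j e f: the first comes from raising (i,e), the second from raising (j,f).
∂coeff₁ : (ℕ → ℕ → ℚ) → ℕ → ℕ → ℕ → ℕ → ℚ
∂coeff₁ c = shift₁ (λ i _ e _ → ι (suc i) * c i e)

∂coeff₂ : (ℕ → ℕ → ℚ) → ℕ → ℕ → ℕ → ℕ → ℚ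
∂coeff₂ c = shift₂ (λ i j e _ → ι (suc j) * c i e)

∂coeff₁-+ : ∀ (c c′ : ℕ → ℕ → ℚ) i j e f →
  ∂coeff₁ (λ i e → c i e + c′ i e) i j e f ≡ ∂coeff₁ c i j e f + ∂coeff₁ c′ i j e f
∂coeff₁-+ c c′ zero    j e       f = sym (+-identityʳ 0ℚ)
∂coeff₁-+ c c′ (suc i) j zero    f = sym (+-identityʳ 0ℚ)
∂coeff₁-+ c c′ (suc i) j (suc e) f = *-distribˡ-+ (ι (suc i)) (c i e) (c′ i e)

∂coeff₂-+ : ∀ (c c′ : ℕ → ℕ → ℚ) i j e f →
  ∂coeff₂ (λ i e → c i e + c′ i e) i j e f ≡ ∂coeff₂ c i j e f + ∂coeff₂ c′ i j e f
∂coeff₂-+ c c′ i zero    e f       = sym (+-identityʳ 0ℚ)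
∂coeff₂-+ c c′ i (suc j) e zero    = sym (+-identityʳ 0ℚ)
∂coeff₂-+ c c′ i (suc j) e (suc f) = *-distribˡ-+ (ι (suc j)) (c i e) (c′ i e)

∂coeff₁-term : ∀ a d i j e f → ∂coeff₁ (term a d) i j e f ≡ ι (suc a) * (ι (i C suc a) * (altC (suc d) e + altC d e))
∂coeff₁-term a d zero    j e       f = sym (trans (cong (ι (suc a) *_) (*-zeroˡ (altC (suc d) e + altC d e))) (*-zeroʳ (ι (suc a))))
∂coeff₁-term a d (suc i) j zero    f =
  sym (trans (cong (λ z → ι (suc a) * (ι (suc i C suc a) * z)) (altC-zero d))
             (trans (cong (ι (suc a) *_) (*-zeroʳ (ι (suc i C suc a)))) (*-zeroʳ (ι (suc a)))))
∂coeff₁-term a d (suc i) j (suc e) f = begin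
  ι (suc i) * (ι (i C a) * altC d e)
    ≡⟨ sym (*-assoc (ι (suc i)) (ι (i C a)) (altC d e)) ⟩
  ι (suc i) * ι (i C a) * altC d e
    ≡⟨ cong (_* altC d e) absorption ⟩
  ι (suc a) * ι (suc i C suc a) * altC d e
    ≡⟨ cong (ι (suc a) * ι (suc i C suc a) *_) (sym (altC-pascal d e)) ⟩
  ι (suc a) * ι (suc i C suc a) * (altC (suc d) (suc e) + altC d (suc e))
    ≡⟨ *-assoc (ι (suc a)) (ι (suc i C suc a)) _ ⟩
  ι (suc a) * (ι (suc i C suc a) * (altC (suc d) (suc e) + altC d (suc e)))
    ∎
  where
  open ≡-Reasoning
  absorption : ι (suc i) * ι (i C a) ≡ ι (suc a) * ι (suc i C suc a)
  absorption = trans (sym (ι-* (suc i) (i C a)))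
                     (trans (cong ι (sym ([k+1]*[n+1]C[k+1]≡[n+1]*nCk i a))) (ι-* (suc a) (suc i C suc a)))

∂coeff₂-term : ∀ a d i j e f → (f ≡ 0 → d < e) → ∂coeff₂ (term a d) i j e f ≡ ι j * term a d i e
∂coeff₂-term a d i zero    e f       _     = sym (*-zeroˡ (term a d i e))
∂coeff₂-term a d i (suc j) e zero    d<e   =
  sym (trans (cong (λ z → ι (suc j) * (ι (i C a) * z)) (altC-vanish (d<e refl)))
             (trans (cong (ι (suc j) *_) (*-zeroʳ (ι (i C a)))) (*-zeroʳ (ι (suc j)))))
∂coeff₂-term a d i (suc j) e (suc f) _ = refl

∂coeff-term : ∀ a b d i j e f → i ℕ.+ j ≡ suc (a ℕ.+ b) → (f ≡ 0 → d < e) →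
  ∂coeff₁ (term a d) i j e f + ∂coeff₂ (term a d) i j e f ≡ ι (suc a) * term (suc a) (suc d) i e + ι (suc b) * term a d i e
∂coeff-term a b d i j e f i+j≡ d<e = begin
  ∂coeff₁ (term a d) i j e f + ∂coeff₂ (term a d) i j e f
    ≡⟨ cong₂ _+_ (∂coeff₁-term a d i j e f) (∂coeff₂-term a d i j e f d<e) ⟩
  ι (suc a) * (x * (altC (suc d) e + altC d e)) + ι j * (y * altC d e)
    ≡⟨ solve 6 (λ A J x y u v → A :* (x :* (u :+ v)) :+ J :* (y :* v) := A :* (x :* u) :+ (A :* x :+ J :* y) :* v)
             refl (ι (suc a)) (ι j) x y (altC (suc d) e) (altC d e) ⟩
  ι (suc a) * (x * altC (suc d) e) + (ι (suc a) * x + ι j * y) * altC d e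
    ≡⟨ cong (λ z → ι (suc a) * (x * altC (suc d) e) + z * altC d e) weights ⟩
  ι (suc a) * (x * altC (suc d) e) + ι (suc b) * y * altC d e
    ≡⟨ cong (λ z → ι (suc a) * (x * altC (suc d) e) + z) (*-assoc (ι (suc b)) y (altC d e)) ⟩
  ι (suc a) * term (suc a) (suc d) i e + ι (suc b) * term a d i e
    ∎
  where
  open ≡-Reasoning
  open ℚ-Solver
  x = ι (i C suc a)
  y = ι (i C a)
  weights : ι (suc a) * x + ι j * y ≡ ι (suc b) * y
  weights = begin
    ι (suc a) * x + ι j * y                           ≡⟨ sym (cong₂ _+_ (ι-* (suc a) (i C suc a)) (ι-* j (i C a))) ⟩
    ι (suc a ℕ.* (i C suc a)) + ι (j ℕ.* (i C a))     ≡⟨ sym (ι-+ (suc a ℕ.* (i C suc a)) (j ℕ.* (i C a))) ⟩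
    ι (suc a ℕ.* (i C suc a) ℕ.+ j ℕ.* (i C a))       ≡⟨ cong ι ([k+1]*nC[k+1]+m*nCk≡[l+1]*nCk a b i j i+j≡) ⟩
    ι (suc b ℕ.* (i C a))                             ≡⟨ ι-* (suc b) (i C a) ⟩
    ι (suc b) * y                                     ∎

∂coeff-shuffleCoeff : ∀ a₁ a₂ d₁ d₂ i j e f → i ℕ.+ j ≡ suc (a₁ ℕ.+ a₂) → e ℕ.+ f ≡ suc (d₁ ℕ.+ d₂) →
  ∂coeff₁ (shuffleCoeff a₁ a₂ d₁ d₂) i j e f + ∂coeff₂ (shuffleCoeff a₁ a₂ d₁ d₂) i j e f ≡
  ι (suc a₁) * shuffleCoeff (suc a₁) a₂ (suc d₁) d₂ i e + ι (suc a₂) * shuffleCoeff a₁ (suc a₂) d₁ (suc d₂) i e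
∂coeff-shuffleCoeff a₁ a₂ d₁ d₂ i j e f i+j≡ e+f≡ = begin
  ∂coeff₁ (shuffleCoeff a₁ a₂ d₁ d₂) i j e f + ∂coeff₂ (shuffleCoeff a₁ a₂ d₁ d₂) i j e f
    ≡⟨ cong₂ _+_ (∂coeff₁-+ (term a₁ d₁) (term a₂ d₂) i j e f) (∂coeff₂-+ (term a₁ d₁) (term a₂ d₂) i j e f) ⟩
  (∂coeff₁ (term a₁ d₁) i j e f + ∂coeff₁ (term a₂ d₂) i j e f) + (∂coeff₂ (term a₁ d₁) i j e f + ∂coeff₂ (term a₂ d₂) i j e f)
    ≡⟨ solve 4 (λ p q r s → (p :+ q) :+ (r :+ s) := (p :+ r) :+ (q :+ s)) refl
         (∂coeff₁ (term a₁ d₁) i j e f) (∂coeff₁ (term a₂ d₂) i j e f) (∂coeff₂ (term a₁ d₁) i j e f) (∂coeff₂ (term a₂ d₂) i j e f) ⟩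
  (∂coeff₁ (term a₁ d₁) i j e f + ∂coeff₂ (term a₁ d₁) i j e f) + (∂coeff₁ (term a₂ d₂) i j e f + ∂coeff₂ (term a₂ d₂) i j e f)
    ≡⟨ cong₂ _+_ (∂coeff-term a₁ a₂ d₁ i j e f i+j≡ d₁<e)
                 (∂coeff-term a₂ a₁ d₂ i j e f (trans i+j≡ (cong suc (ℕ.+-comm a₁ a₂))) d₂<e) ⟩
  (A₁ * term (suc a₁) (suc d₁) i e + A₂ * term a₁ d₁ i e) + (A₂ * term (suc a₂) (suc d₂) i e + A₁ * term a₂ d₂ i e)
    ≡⟨ solve 6 (λ A₁ A₂ p q r s → (A₁ :* p :+ A₂ :* q) :+ (A₂ :* r :+ A₁ :* s) := A₁ :* (p :+ s) :+ A₂ :* (q :+ r)) refl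
         A₁ A₂ (term (suc a₁) (suc d₁) i e) (term a₁ d₁ i e) (term (suc a₂) (suc d₂) i e) (term a₂ d₂ i e) ⟩
  A₁ * shuffleCoeff (suc a₁) a₂ (suc d₁) d₂ i e + A₂ * shuffleCoeff a₁ (suc a₂) d₁ (suc d₂) i e
    ∎
  where
  open ≡-Reasoning
  open ℚ-Solver
  A₁ = ι (suc a₁)
  A₂ = ι (suc a₂)
  e≡ : f ≡ 0 → e ≡ suc (d₁ ℕ.+ d₂)
  e≡ refl = trans (sym (ℕ.+-identityʳ e)) e+f≡
  d₁<e : f ≡ 0 → d₁ < e
  d₁<e f≡0 rewrite e≡ f≡0 = s≤s (ℕ.m≤m+n d₁ d₂)
  d₂<e : f ≡ 0 → d₂ < e
  d₂<e f≡0 rewrite e≡ f≡0 = s≤s (ℕ.m≤n+m d₂ d₁)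

∂₂ : (ℕ → ℕ → ℕ → ℕ → Sym) → ℕ → ℕ → ℕ → ℕ → Lin
∂₂ X k₁ k₂ d₁ d₂ = (ι k₁ , X (suc k₁) k₂ (suc d₁) d₂) ∷ (ι k₂ , X k₁ (suc k₂) d₁ (suc d₂)) ∷ []

∂ : Sym → Lin
∂ = ∂with (∂₂ P)

coeff-∂₂ : ∀ s X k₁ k₂ d₁ d₂ → coeff s (∂₂ X k₁ k₂ d₁ d₂) ≡
  ι k₁ * coeff s (η (X (suc k₁) k₂ (suc d₁) d₂)) + ι k₂ * coeff s (η (X k₁ (suc k₂) d₁ (suc d₂)))
coeff-∂₂ s X k₁ k₂ d₁ d₂ = cong₂ _+_ (coeff-η s _ (ι k₁)) (coeff-singleton s (ι k₂) _)

Family : Set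
Family = ℕ → ℕ → ℕ → ℕ → Lin

LeibnizAt : Family → ℕ → ℕ → ℕ → ℕ → Set
LeibnizAt F k₁ k₂ d₁ d₂ = ∀ s →
  coeff s (extend ∂ (F k₁ k₂ d₁ d₂)) ≡ ι k₁ * coeff s (F (suc k₁) k₂ (suc d₁) d₂) + ι k₂ * coeff s (F k₁ (suc k₂) d₁ (suc d₂))

LeibnizAt-++ : ∀ (F G : Family) {k₁ k₂ d₁ d₂} → LeibnizAt F k₁ k₂ d₁ d₂ → LeibnizAt G k₁ k₂ d₁ d₂ →
  LeibnizAt (λ k₁ k₂ d₁ d₂ → F k₁ k₂ d₁ d₂ ++ G k₁ k₂ d₁ d₂) k₁ k₂ d₁ d₂
LeibnizAt-++ F G {k₁} {k₂} {d₁} {d₂} ∂F ∂G s = begin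
  coeff s (extend ∂ (F k₁ k₂ d₁ d₂ ++ G k₁ k₂ d₁ d₂))
    ≡⟨ coeff-extend-++ s ∂ (F k₁ k₂ d₁ d₂) (G k₁ k₂ d₁ d₂) ⟩
  coeff s (extend ∂ (F k₁ k₂ d₁ d₂)) + coeff s (extend ∂ (G k₁ k₂ d₁ d₂))
    ≡⟨ cong₂ _+_ (∂F s) (∂G s) ⟩
  (ι k₁ * coeff s F⁺¹ + ι k₂ * coeff s F⁺²) + (ι k₁ * coeff s G⁺¹ + ι k₂ * coeff s G⁺²)
    ≡⟨ solve 6 (λ a b x y u v → (a :* x :+ b :* y) :+ (a :* u :+ b :* v) := a :* (x :+ u) :+ b :* (y :+ v))
             refl (ι k₁) (ι k₂) (coeff s F⁺¹) (coeff s F⁺²) (coeff s G⁺¹) (coeff s G⁺²) ⟩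
  ι k₁ * (coeff s F⁺¹ + coeff s G⁺¹) + ι k₂ * (coeff s F⁺² + coeff s G⁺²)
    ≡⟨ sym (cong₂ (λ u v → ι k₁ * u + ι k₂ * v) (coeff-++ s F⁺¹ G⁺¹) (coeff-++ s F⁺² G⁺²)) ⟩
  ι k₁ * coeff s (F⁺¹ ++ G⁺¹) + ι k₂ * coeff s (F⁺² ++ G⁺²)
    ∎
  where
  open ℚ-Solver
  open ≡-Reasoning
  F⁺¹ = F (suc k₁) k₂ (suc d₁) d₂
  F⁺² = F k₁ (suc k₂) d₁ (suc d₂)
  G⁺¹ = G (suc k₁) k₂ (suc d₁) d₂
  G⁺² = G k₁ (suc k₂) d₁ (suc d₂)

LeibnizAt-scale : ∀ q (F : Family) {k₁ k₂ d₁ d₂} → LeibnizAt F k₁ k₂ d₁ d₂ →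
  LeibnizAt (λ k₁ k₂ d₁ d₂ → scale q (F k₁ k₂ d₁ d₂)) k₁ k₂ d₁ d₂
LeibnizAt-scale q F {k₁} {k₂} {d₁} {d₂} ∂F s = begin
  coeff s (extend ∂ (scale q (F k₁ k₂ d₁ d₂)))
    ≡⟨ coeff-extend-scale s ∂ q (F k₁ k₂ d₁ d₂) ⟩
  q * coeff s (extend ∂ (F k₁ k₂ d₁ d₂))
    ≡⟨ cong (q *_) (∂F s) ⟩
  q * (ι k₁ * coeff s F⁺¹ + ι k₂ * coeff s F⁺²)
    ≡⟨ solve 5 (λ q a b x y → q :* (a :* x :+ b :* y) := a :* (q :* x) :+ b :* (q :* y)) refl q (ι k₁) (ι k₂) (coeff s F⁺¹) (coeff s F⁺²) ⟩
  ι k₁ * (q * coeff s F⁺¹) + ι k₂ * (q * coeff s F⁺²)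
    ≡⟨ sym (cong₂ (λ u v → ι k₁ * u + ι k₂ * v) (coeff-scale s q F⁺¹) (coeff-scale s q F⁺²)) ⟩
  ι k₁ * coeff s (scale q F⁺¹) + ι k₂ * coeff s (scale q F⁺²)
    ∎
  where
  open ℚ-Solver
  open ≡-Reasoning
  F⁺¹ = F (suc k₁) k₂ (suc d₁) d₂
  F⁺² = F k₁ (suc k₂) d₁ (suc d₂)

LeibnizAt-η : ∀ X {k₁ k₂ d₁ d₂} → ∂ (X k₁ k₂ d₁ d₂) ≡ ∂₂ X k₁ k₂ d₁ d₂ →
  LeibnizAt (λ k₁ k₂ d₁ d₂ → η (X k₁ k₂ d₁ d₂)) k₁ k₂ d₁ d₂
LeibnizAt-η X {k₁} {k₂} {d₁} {d₂} ∂X≡ s =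
  trans (coeff-extend-unit s ∂ (X k₁ k₂ d₁ d₂)) (trans (cong (coeff s) ∂X≡) (coeff-∂₂ s X k₁ k₂ d₁ d₂))

LeibnizAt-G₂-swap : ∀ {k₁ k₂ d₁ d₂} → LeibnizAt (λ k₁ k₂ d₁ d₂ → η (G₂ k₂ k₁ d₂ d₁)) k₁ k₂ d₁ d₂
LeibnizAt-G₂-swap {k₁} {k₂} {d₁} {d₂} s =
  trans (coeff-extend-unit s ∂ (G₂ k₂ k₁ d₂ d₁)) (trans (coeff-∂₂ s G₂ k₂ k₁ d₂ d₁)
    (+-comm (ι k₂ * coeff s (η (G₂ (suc k₂) k₁ (suc d₂) d₁))) (ι k₁ * coeff s (η (G₂ k₂ (suc k₁) d₂ (suc d₁))))))

LeibnizAt-G₁-sum : ∀ {k₁ k₂ d₁ d₂} → LeibnizAt (λ k₁ k₂ d₁ d₂ → η (G₁ (k₁ ℕ.+ k₂) (d₁ ℕ.+ d₂))) k₁ k₂ d₁ d₂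
LeibnizAt-G₁-sum {k₁} {k₂} {d₁} {d₂} s = begin
  coeff s (extend ∂ (η (G₁ (k₁ ℕ.+ k₂) (d₁ ℕ.+ d₂))))
    ≡⟨ trans (coeff-extend-unit s ∂ (G₁ (k₁ ℕ.+ k₂) (d₁ ℕ.+ d₂)))
             (coeff-singleton s (ι (k₁ ℕ.+ k₂)) (G₁ (suc (k₁ ℕ.+ k₂)) (suc (d₁ ℕ.+ d₂)))) ⟩
  ι (k₁ ℕ.+ k₂) * δ
    ≡⟨ trans (cong (_* δ) (ι-+ k₁ k₂)) (*-distribʳ-+ δ (ι k₁) (ι k₂)) ⟩
  ι k₁ * δ + ι k₂ * δ
    ≡⟨ cong (λ m → ι k₁ * δ + ι k₂ * coeff s (η (G₁ m (suc (d₁ ℕ.+ d₂))))) (sym (ℕ.+-suc k₁ k₂)) ⟩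
  ι k₁ * δ + ι k₂ * coeff s (η (G₁ (k₁ ℕ.+ suc k₂) (suc (d₁ ℕ.+ d₂))))
    ≡⟨ cong (λ m → ι k₁ * δ + ι k₂ * coeff s (η (G₁ (k₁ ℕ.+ suc k₂) m))) (sym (ℕ.+-suc d₁ d₂)) ⟩
  ι k₁ * δ + ι k₂ * coeff s (η (G₁ (k₁ ℕ.+ suc k₂) (d₁ ℕ.+ suc d₂)))
    ∎
  where
  open ≡-Reasoning
  δ = coeff s (η (G₁ (suc (k₁ ℕ.+ k₂)) (suc (d₁ ℕ.+ d₂))))

LeibnizAt-stuffleSide : ∀ k₁ k₂ d₁ d₂ → LeibnizAt stuffleSide k₁ k₂ d₁ d₂
LeibnizAt-stuffleSide k₁ k₂ d₁ d₂ =
  LeibnizAt-++ (λ k₁ k₂ d₁ d₂ → η (G₂ k₁ k₂ d₁ d₂)) (λ k₁ k₂ d₁ d₂ → η (G₂ k₂ k₁ d₂ d₁) ++ η (G₁ (k₁ ℕ.+ k₂) (d₁ ℕ.+ d₂)))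
    (LeibnizAt-η G₂ {k₁} {k₂} {d₁} {d₂} refl)
    (LeibnizAt-++ (λ k₁ k₂ d₁ d₂ → η (G₂ k₂ k₁ d₂ d₁)) (λ k₁ k₂ d₁ d₂ → η (G₁ (k₁ ℕ.+ k₂) (d₁ ℕ.+ d₂)))
      (LeibnizAt-G₂-swap {k₁} {k₂} {d₁} {d₂}) (LeibnizAt-G₁-sum {k₁} {k₂} {d₁} {d₂}))

Σ²-∂-transpose : ∀ n D (c : ℕ → ℕ → ℚ) (g : ℕ → ℕ → ℕ → ℕ → ℚ) →
  Σ²⟨ n , D ⟩ (λ i j e f → c i e * (ι (suc i) * g (suc i) j (suc e) f + ι (suc j) * g i (suc j) e (suc f))) ≡
  Σ²⟨ suc n , suc D ⟩ (λ i j e f → (∂coeff₁ c i j e f + ∂coeff₂ c i j e f) * g i j e f)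
Σ²-∂-transpose n D c g = begin
  Σ²⟨ n , D ⟩ (λ i j e f → c i e * (ι (suc i) * g (suc i) j (suc e) f + ι (suc j) * g i (suc j) e (suc f)))
    ≡⟨ Σ²-cong n D (λ i j e f _ _ → solve 5 (λ c x y u v → c :* (x :* u :+ y :* v) := x :* c :* u :+ y :* c :* v) refl
                                          (c i e) (ι (suc i)) (ι (suc j)) (g (suc i) j (suc e) f) (g i (suc j) e (suc f))) ⟩
  Σ²⟨ n , D ⟩ (λ i j e f → ι (suc i) * c i e * g (suc i) j (suc e) f + ι (suc j) * c i e * g i (suc j) e (suc f))
    ≡⟨ Σ²-+ n D (λ i j e f → ι (suc i) * c i e * g (suc i) j (suc e) f) (λ i j e f → ι (suc j) * c i e * g i (suc j) e (suc f)) ⟩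
  Σ²⟨ n , D ⟩ (λ i j e f → ι (suc i) * c i e * g (suc i) j (suc e) f) + Σ²⟨ n , D ⟩ (λ i j e f → ι (suc j) * c i e * g i (suc j) e (suc f))
    ≡⟨ sym (cong₂ _+_ (Σ²-shift₁ n D (λ i _ e _ → ι (suc i) * c i e) g) (Σ²-shift₂ n D (λ i j e _ → ι (suc j) * c i e) g)) ⟩
  Σ²⟨ suc n , suc D ⟩ (λ i j e f → ∂coeff₁ c i j e f * g i j e f) + Σ²⟨ suc n , suc D ⟩ (λ i j e f → ∂coeff₂ c i j e f * g i j e f)
    ≡⟨ sym (Σ²-+ (suc n) (suc D) (λ i j e f → ∂coeff₁ c i j e f * g i j e f) (λ i j e f → ∂coeff₂ c i j e f * g i j e f)) ⟩
  Σ²⟨ suc n , suc D ⟩ (λ i j e f → ∂coeff₁ c i j e f * g i j e f + ∂coeff₂ c i j e f * g i j e f)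
    ≡⟨ Σ²-cong (suc n) (suc D) (λ i j e f _ _ → sym (*-distribʳ-+ (g i j e f) (∂coeff₁ c i j e f) (∂coeff₂ c i j e f))) ⟩
  Σ²⟨ suc n , suc D ⟩ (λ i j e f → (∂coeff₁ c i j e f + ∂coeff₂ c i j e f) * g i j e f)
    ∎
  where
  open ≡-Reasoning
  open ℚ-Solver

LeibnizAt-shuffleSide : ∀ a₁ a₂ d₁ d₂ → LeibnizAt shuffleSide (suc a₁) (suc a₂) d₁ d₂
LeibnizAt-shuffleSide a₁ a₂ d₁ d₂ s = begin
  coeff s (extend ∂ (shuffleSide (suc a₁) (suc a₂) d₁ d₂))
    ≡⟨ coeff-extend-shuffleSide s ∂ a₁ a₂ d₁ d₂ refl refl ⟩
  Σ²⟨ n , D ⟩ (λ i j e f → c i e * coeff s (∂ (G₂ (suc i) (suc j) e f))) + T * coeff s (∂ (G₁ (suc n) (suc D)))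
    ≡⟨ cong₂ _+_ (Σ²-cong n D (λ i j e f _ _ → cong (c i e *_) (coeff-∂₂ s G₂ (suc i) (suc j) e f)))
                 (cong (T *_) (coeff-singleton s (ι (suc n)) (G₁ (suc (suc n)) (suc (suc D))))) ⟩
  Σ²⟨ n , D ⟩ (λ i j e f → c i e * (ι (suc i) * Γ (suc i) j (suc e) f + ι (suc j) * Γ i (suc j) e (suc f))) + T * (ι (suc n) * δ)
    ≡⟨ cong₂ _+_ (Σ²-∂-transpose n D c Γ) (sym (*-assoc T (ι (suc n)) δ)) ⟩
  Σ²⟨ suc n , suc D ⟩ (λ i j e f → (∂coeff₁ c i j e f + ∂coeff₂ c i j e f) * Γ i j e f) + T * ι (suc n) * δ
    ≡⟨ cong₂ _+_ (Σ²-cong (suc n) (suc D) (λ i j e f i+j≡ e+f≡ → cong (_* Γ i j e f) (∂coeff-shuffleCoeff a₁ a₂ d₁ d₂ i j e f i+j≡ e+f≡)))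
                 (cong (_* δ) (G₁-coeff-rec a₁ a₂ d₁ d₂)) ⟩
  Σ²⟨ suc n , suc D ⟩ (λ i j e f → (A₁ * c′ i e + A₂ * c″ i e) * Γ i j e f) + (A₁ * T′ + A₂ * T″) * δ
    ≡⟨ cong (_+ (A₁ * T′ + A₂ * T″) * δ) (Σ²-linear (suc n) (suc D) A₁ A₂ (λ i _ e _ → c′ i e) (λ i _ e _ → c″ i e) Γ) ⟩
  A₁ * Σ′ + A₂ * Σ″ + (A₁ * T′ + A₂ * T″) * δ
    ≡⟨ solve 7 (λ A₁ A₂ x y T′ T″ δ → A₁ :* x :+ A₂ :* y :+ (A₁ :* T′ :+ A₂ :* T″) :* δ := A₁ :* (x :+ T′ :* δ) :+ A₂ :* (y :+ T″ :* δ))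
             refl A₁ A₂ Σ′ Σ″ T′ T″ δ ⟩
  A₁ * (Σ′ + T′ * δ) + A₂ * (Σ″ + T″ * δ)
    ≡⟨ sym (cong₂ (λ u v → A₁ * u + A₂ * v) (coeff-shuffleSide s (suc a₁) a₂ (suc d₁) d₂ refl refl)
                                            (coeff-shuffleSide s a₁ (suc a₂) d₁ (suc d₂) (ℕ.+-suc a₁ a₂) (ℕ.+-suc d₁ d₂))) ⟩
  A₁ * coeff s (shuffleSide (suc (suc a₁)) (suc a₂) (suc d₁) d₂) + A₂ * coeff s (shuffleSide (suc a₁) (suc (suc a₂)) d₁ (suc d₂))
    ∎
  where
  open ℚ-Solver
  open ≡-Reasoning
  n = a₁ ℕ.+ a₂
  D = d₁ ℕ.+ d₂
  A₁ = ι (suc a₁)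
  A₂ = ι (suc a₂)
  c = shuffleCoeff a₁ a₂ d₁ d₂
  c′ = shuffleCoeff (suc a₁) a₂ (suc d₁) d₂
  c″ = shuffleCoeff a₁ (suc a₂) d₁ (suc d₂)
  T = factQuot d₁ d₂ * ι (n C a₁)
  T′ = factQuot (suc d₁) d₂ * ι (suc n C suc a₁)
  T″ = factQuot d₁ (suc d₂) * ι (suc n C a₁)
  Γ : ℕ → ℕ → ℕ → ℕ → ℚ
  Γ i j e f = coeff s (η (G₂ (suc i) (suc j) e f))
  δ = coeff s (η (G₁ (suc (suc n)) (suc (suc D))))
  Σ′ = Σ²⟨ suc n , suc D ⟩ (λ i j e f → c′ i e * Γ i j e f)
  Σ″ = Σ²⟨ suc n , suc D ⟩ (λ i j e f → c″ i e * Γ i j e f)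

LeibnizAt-P-minus : ∀ (S : Family) {k₁ k₂ d₁ d₂} → LeibnizAt S k₁ k₂ d₁ d₂ →
  LeibnizAt (λ k₁ k₂ d₁ d₂ → η (P k₁ k₂ d₁ d₂) ++ neg (S k₁ k₂ d₁ d₂)) k₁ k₂ d₁ d₂
LeibnizAt-P-minus S {k₁} {k₂} {d₁} {d₂} ∂S =
  LeibnizAt-++ (λ k₁ k₂ d₁ d₂ → η (P k₁ k₂ d₁ d₂)) (λ k₁ k₂ d₁ d₂ → neg (S k₁ k₂ d₁ d₂))
    (LeibnizAt-η P {k₁} {k₂} {d₁} {d₂} refl) (LeibnizAt-scale (- 1ℚ) S ∂S)

side : RelKind → Family
side relA = stuffleSide
side relB = shuffleSide

LeibnizAt-relator : ∀ r {k₁ k₂ d₁ d₂} → LeibnizAt (side r) k₁ k₂ d₁ d₂ → LeibnizAt (relator r) k₁ k₂ d₁ d₂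
LeibnizAt-relator relA = LeibnizAt-P-minus stuffleSide
LeibnizAt-relator relB = LeibnizAt-P-minus shuffleSide

LeibnizAt-side : ∀ r a₁ a₂ d₁ d₂ → LeibnizAt (side r) (suc a₁) (suc a₂) d₁ d₂
LeibnizAt-side relA a₁ a₂ d₁ d₂ = LeibnizAt-stuffleSide (suc a₁) (suc a₂) d₁ d₂
LeibnizAt-side relB = LeibnizAt-shuffleSide

∂-combination : RelKind → ℕ → ℕ → ℕ → ℕ → List (ℚ × RelIdx)
∂-combination r k₁ k₂ d₁ d₂ = (ι k₁ , (r , suc k₁ , k₂ , suc d₁ , d₂)) ∷ (ι k₂ , (r , k₁ , suc k₂ , d₁ , suc d₂)) ∷ []

∂-relator : ∀ r k₁ k₂ d₁ d₂ → LeibnizAt (relator r) k₁ k₂ d₁ d₂ →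
  extend ∂ (relator r k₁ k₂ d₁ d₂) ≈ combine (∂-combination r k₁ k₂ d₁ d₂)
∂-relator r k₁ k₂ d₁ d₂ ∂R s = begin
  coeff s (extend ∂ (relator r k₁ k₂ d₁ d₂))
    ≡⟨ ∂R s ⟩
  ι k₁ * coeff s R⁺¹ + ι k₂ * coeff s R⁺²
    ≡⟨ sym (cong₂ _+_ (coeff-scale s (ι k₁) R⁺¹)
                      (trans (coeff-++ s (scale (ι k₂) R⁺²) []) (trans (+-identityʳ _) (coeff-scale s (ι k₂) R⁺²)))) ⟩
  coeff s (scale (ι k₁) R⁺¹) + coeff s (scale (ι k₂) R⁺² ++ [])
    ≡⟨ sym (coeff-++ s (scale (ι k₁) R⁺¹) (scale (ι k₂) R⁺² ++ [])) ⟩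
  coeff s (combine (∂-combination r k₁ k₂ d₁ d₂))
    ∎
  where
  open ≡-Reasoning
  R⁺¹ = relator r (suc k₁) k₂ (suc d₁) d₂
  R⁺² = relator r k₁ (suc k₂) d₁ (suc d₂)

∂-combination-valid : ∀ r a₁ a₂ d₁ d₂ {K} → suc a₁ ℕ.+ suc a₂ ℕ.+ d₁ ℕ.+ d₂ ≡ K →
  All (λ x → ValidIn (K ℕ.+ 2) (proj₂ x)) (∂-combination r (suc a₁) (suc a₂) d₁ d₂)
∂-combination-valid r a₁ a₂ d₁ d₂ refl =
  (s≤s z≤n , s≤s z≤n , solve 4 (λ a b c d → (con 1 :+ a) :+ b :+ (con 1 :+ c) :+ d := a :+ b :+ c :+ d :+ con 2) refl k₁ k₂ d₁ d₂) ∷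
  (s≤s z≤n , s≤s z≤n , solve 4 (λ a b c d → a :+ (con 1 :+ b) :+ c :+ (con 1 :+ d) := a :+ b :+ c :+ d :+ con 2) refl k₁ k₂ d₁ d₂) ∷ []
  where
  open ℕ-Solver
  k₁ = suc a₁
  k₂ = suc a₂

proposition2p7 : (K : ℕ) → 1 ≤ K →
    Σ (ℕ → ℕ → ℕ → ℕ → Lin) λ ∂P →
      (r : RelKind) (k₁ k₂ d₁ d₂ : ℕ) → 1 ≤ k₁ → 1 ≤ k₂ → k₁ ℕ.+ k₂ ℕ.+ d₁ ℕ.+ d₂ ≡ K →
        InRel (K ℕ.+ 2) (extend (∂with ∂P) (relator r k₁ k₂ d₁ d₂))
proposition2p7 K _ = ∂₂ P , ∂-relator-InRel
  where
  ∂-relator-InRel : (r : RelKind) (k₁ k₂ d₁ d₂ : ℕ) → 1 ≤ k₁ → 1 ≤ k₂ → k₁ ℕ.+ k₂ ℕ.+ d₁ ℕ.+ d₂ ≡ K →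
    InRel (K ℕ.+ 2) (extend ∂ (relator r k₁ k₂ d₁ d₂))
  ∂-relator-InRel r (suc a₁) (suc a₂) d₁ d₂ (s≤s z≤n) (s≤s z≤n) weight =
    ∂-combination r (suc a₁) (suc a₂) d₁ d₂ , ∂-combination-valid r a₁ a₂ d₁ d₂ weight ,
    ∂-relator r (suc a₁) (suc a₂) d₁ d₂ (LeibnizAt-relator r (LeibnizAt-side r a₁ a₂ d₁ d₂))
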